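{- Let $P=(L,\ell_0,G,\ell_\mathrm{err})$ and $P'=(L',\ell'_0,G',\ell'_\mathrm{err})$ be control-flow automata and let $DG(P,P')=(N,E,n_0,\Delta)$ be a difference graph for $P$ and $P'$ (for instance, the output of any difference detector). Let $A$ be the condition returned by the condition generator (described in the context) on input $DG(P,P')$. Then $A$ covers no path with a regression bug, i.e. $cover(A)\cap paths^\mathrm{rb}(P,P')=\emptyset$.
   Context: Programs operate on variables; a concrete data state $c$ assigns a value to every variable. $Ops$ is a set of operations, each either an assignment or an assume operation. An assume operation $op$ is a predicate on data states (write $c\models op$); for an assignment $op$, $SP_{op}(c)$ denotes the data state after executing $op$ in $c$. A control-flow automaton (CFA) $P=(L,\ell_0,G,\ell_\mathrm{err})$ consists of a set $L$ of locations, an initial location $\ell_0\in L$, an error location $\ell_\mathrm{err}\in L$, and control-flow edges $G\subseteq L\times Ops\times L$. An executable program path of $P$ is a sequence $(\ell_0,c_0)\xrightarrow{g_1}(\ell_1,c_1)\xrightarrow{g_2}\cdots\xrightarrow{g_n}(\ell_n,c_n)$, $n\ge 0$, starting at $\ell_0$ with an arbitrary data state $c_0$, such that for each $1\le i\le n$, $g_i=(\ell_{i-1},op_i,\ell_i)\in G$ and: if $op_i$ is an assume operation then $c_{i-1}\models op_i$ and $c_i=c_{i-1}$; if $op_i$ is an assignment then $c_i=SP_{op_i}(c_{i-1})$. $paths^\mathrm{err}(P)$ is the set of executable paths of $P$ that visit $\ell_\mathrm{err}$ (some $\ell_i=\ell_\mathrm{err}$). For an original CFA $P$ and a modified CFA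 $P'$, $paths^\mathrm{rb}(P,P')$ (paths with regression bugs) is the set of $\pi'\in paths^\mathrm{err}(P')$ with initial data state $c'_0$ such that there is no $\pi\in paths^\mathrm{err}(P)$ whose initial data state equals $c'_0$. A difference graph $DG(P,P')=(N,E,n_0,\Delta)$ consists of a set $N$ of nodes, an initial node $n_0\in N$, a set $\Delta\subseteq N$ of regression-bug indicator nodes, and edges $E\subseteq N\times G'\times N$, such that: for every $\pi'=(\ell'_0,c'_0)\xrightarrow{g'_1}\cdots\xrightarrow{g'_n}(\ell'_n,c'_n)\in paths^\mathrm{rb}(P,P')$, every $0\le k\le n$ and every sequence $n_0\xrightarrow{g'_1}n_1\cdots\xrightarrow{g'_k}n_k$ with $(n_{i-1},g'_i,n_i)\in E$ for all $i$, there is a sequence $n_k\to n_{k+1}\to\cdots\to n_{k+m}$ of edges of $E$ ($m\ge 0$) with $n_{k+m}\in\Delta$. A condition $A=(Q,\delta,q_0,F)$ consists of a finite set $Q$ of states, initial state $q_0\in Q$, accepting states $F\subseteq Q$, and a transition relation $\delta\subseteq Q\times G'\times Q$ such that no transition leaves an accepting state. $A$ covers an executable path $(\ell'_0,c'_0)\xrightarrow{g'_1}\cdots\xrightarrow{g'_n}(\ell'_n,c'_n)$ of $P'$ (written $\pi'\in cover(A)$) if there is a run $q_0\xrightarrow{g'_1}q_1\cdots\xrightarrow{g'_k}q_k$ with $(q_{i-1},g'_i,q_i)\in\delta$, $0\le k\le n$, and $q_k\in F$. Condition generator on input $(N,E,n_0,\Delta)$: set $Q:=\{n_0\}\cup\Delta$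 and $waitlist:=\{n_0\}\cup\Delta$. While $waitlist\neq\emptyset$: remove some $n_s$ from $waitlist$, and for each edge $(n_p,g,n_s)\in E$ with $n_p\notin Q$, add $n_p$ to $Q$ and to $waitlist$. Then let $F:=\{n_s\mid \exists (n_p,g,n_s)\in E,\ n_p\in Q,\ n_s\notin Q\}$ and return the condition $(Q\cup F,\ E\cap(Q\times G'\times(Q\cup F)),\ n_0,\ F)$. -}

module Defs where

open import Level using (Level; _⊔_) renaming (suc to lsuc)
open import Data.Nat using (ℕ; _≤_)
open import Data.List using (List; []; _∷_; map; take; length)
open import Data.List.Relation.Unary.Any using (Any)
open import Data.Product using (Σ; ∃; _×_; _,_; proj₁; proj₂)
open import Data.Sum using (_⊎_; inj₁; inj₂)
open import Data.Unit using (⊤)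
open import Data.Empty using (⊥)
open import Relation.Nullary using (¬_)
open import Relation.Binary.PropositionalEquality using (_≡_)
open import Relation.Binary.Construct.Closure.ReflexiveTransitive using (Star)

DataState : Set → Set → Set
DataState Var Val = Var → Val

-- An operation is an assume operation (a predicate on data states)
-- or an assignment (given by its strongest-post transformer SP_op).
data Op (Var Val : Set) : Set₁ where
  assume : (DataState Var Val → Set) → Op Var Val
  assign : (DataState Var Val → DataState Var Val) → Op Var Val

Step : {Var Val : Set} → Op Var Val → DataState Var Val → DataState Var Val → Set
Step (assume φ) c c' = φ c × c' ≡ c
Step (assign f) c c' = c' ≡ f c

record CFA (Var Val : Set) : Set₁ where
  field
    Loc  : Set
    ℓ₀   : Loc
    G    : Loc → Op Var Val → Loc → Set
    ℓerr : Loc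

open CFA public

Lab : {Var Val : Set} → CFA Var Val → Set₁
Lab {Var} {Val} P = Loc P × Op Var Val × Loc P

InG : {Var Val : Set} (P : CFA Var Val) → Lab P → Set
InG P (a , op , b) = G P a op b

Exec : {Var Val : Set} (P : CFA Var Val) → Loc P → DataState Var Val
     → List (Lab P × DataState Var Val) → Set
Exec P ℓ c [] = ⊤
Exec P ℓ c (((a , op , b) , c') ∷ rest) =
  a ≡ ℓ × G P a op b × Step op c c' × Exec P b c' rest

record Path {Var Val : Set} (P : CFA Var Val) : Set₁ where
  field
    c₀    : DataState Var Val
    steps : List (Lab P × DataState Var Val)
    exec  : Exec P (ℓ₀ P) c₀ steps

open Path public

labels : {Var Val : Set} {P : CFA Var Val} → Path P → List (Lab P)
labels π = map proj₁ (steps π)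

target : {Var Val : Set} {P : CFA Var Val} → Lab P × DataState Var Val → Loc P
target ((a , op , b) , c) = b

VisitsErr : {Var Val : Set} (P : CFA Var Val) → Path P → Set₁
VisitsErr P π = ℓ₀ P ≡ ℓerr P ⊎ Any (λ s → target {P = P} s ≡ ℓerr P) (steps π)

RegressionBug : {Var Val : Set} (P P' : CFA Var Val) → Path P' → Set₁
RegressionBug P P' π' =
  VisitsErr P' π' × ¬ (Σ (Path P) λ π → VisitsErr P π × c₀ π ≡ c₀ π')

data LRun {s a r : Level} {S : Set s} {A : Set a} (R : S → A → S → Set r)
          : S → List A → S → Set (s ⊔ a ⊔ r) where
  []  : ∀ {x} → LRun R x [] x
  _∷_ : ∀ {x g y gs z} → R x g y → LRun R y gs z → LRun R x (g ∷ gs) z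

record DiffGraph {Var Val : Set} (P P' : CFA Var Val) : Set₂ where
  field
    N    : Set
    E    : N → Lab P' → N → Set
    n₀   : N
    Δ    : N → Set
    E⊆G' : ∀ {n g m} → E n g m → InG P' g
    sound : (π' : Path P') → RegressionBug P P' π' →
            (k : ℕ) → k ≤ length (steps π') →
            (nk : N) → LRun E n₀ (take k (labels π')) nk →
            Σ N λ m → Star (λ x y → Σ (Lab P') λ g → E x g y) nk m × Δ m

record Condition {Var Val : Set} (P' : CFA Var Val) : Set₂ where
  field
    St  : Set₁
    δ   : St → Lab P' → St → Set₁
    q₀  : St
    Acc : St → Set₁
    noExit : ∀ {q g q'} → Acc q → δ q g q' → ⊥

Covers : {Var Val : Set} {P' : CFA Var Val} → Condition P' → Path P' → Set₁
Covers A π' =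
  Σ ℕ λ k → k ≤ length (steps π') ×
    Σ (Condition.St A) λ q →
      LRun (Condition.δ A) (Condition.q₀ A) (take k (labels π')) q × Condition.Acc A q

module Generator {Var Val : Set} {P P' : CFA Var Val} (D : DiffGraph P P') where
  open DiffGraph D

  -- The set Q computed by the worklist loop: it starts with {n₀} ∪ Δ
  -- and adds every E-predecessor of a node already in Q, until saturation.
  data InQ : N → Set₁ where
    init : InQ n₀
    bug  : ∀ {n} → Δ n → InQ n
    pred : ∀ {np g ns} → E np g ns → InQ ns → InQ np

  InF : N → Set₁
  InF ns = Σ N λ np → Σ (Lab P') λ g → E np g ns × InQ np × ¬ InQ ns

  State : Set₁
  State = Σ N λ n → InQ n ⊎ InF n

  -- δ := E ∩ (Q × G' × (Q ∪ F))
  Trans : State → Lab P' → State → Set₁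
  Trans (n , _) g (m , _) = E n g m × InQ n

  Accept : State → Set₁
  Accept (n , _) = InF n

  noExit : ∀ {q g q'} → Accept q → Trans q g q' → ⊥
  noExit (np , g , e , qp , nq) (_ , qn) = nq qn

  condition : Condition P'
  condition = record
    { St = State ; δ = Trans ; q₀ = (n₀ , inj₁ init)
    ; Acc = Accept ; noExit = λ {q} {g} {q'} → noExit {q} {g} {q'} }

generateCondition : {Var Val : Set} {P P' : CFA Var Val} → DiffGraph P P' → Condition P'
generateCondition D = Generator.condition D

{-# OPTIONS --safe #-}
-- Q is closed under E-predecessors and contains Δ, so every node from which Δ is
-- reachable lies in Q. An accepting state of the generated condition is a node
-- outside Q, hence Δ is unreachable from it. A run of the condition over a prefix
-- of π' is a run of the difference graph, so if π' had a regression bug the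
-- soundness of the difference graph would let us reach Δ from that node.
module Submission where

open import Level using (Level)
open import Defs
open import Relation.Nullary using (¬_)
open import Data.Product using (_×_; _,_; Σ; proj₁)
open import Relation.Binary.Construct.Closure.ReflexiveTransitive using (Star; ε; _◅_)

LRun-map : ∀ {s s′ a r r′ : Level} {S : Set s} {S′ : Set s′} {A : Set a}
           {R : S → A → S → Set r} {R′ : S′ → A → S′ → Set r′} (f : S → S′) →
           (∀ {x g y} → R x g y → R′ (f x) g (f y)) →
           ∀ {x gs y} → LRun R x gs y → LRun R′ (f x) gs (f y)
LRun-map f h []      = []
LRun-map f h (r ∷ rs) = h r ∷ LRun-map f h rs

Star-backward-closed : ∀ {s r p : Level} {S : Set s} {R : S → S → Set r}
                       (Q : S → Set p) → (∀ {x y} → R x y → Q y → Q x) →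
                       ∀ {x y} → Star R x y → Q y → Q x
Star-backward-closed Q closed ε        qy = qy
Star-backward-closed Q closed (r ◅ rs) qy = closed r (Star-backward-closed Q closed rs qy)

module _ {Var Val : Set} {P P' : CFA Var Val} (D : DiffGraph P P') where
  open DiffGraph D
  open Generator D

  Edge : N → N → Set₁
  Edge x y = Σ (Lab P') λ g → E x g y

  reaches-Δ⇒InQ : ∀ {n m} → Star Edge n m → Δ m → InQ n
  reaches-Δ⇒InQ path δm =
    Star-backward-closed InQ (λ (_ , e) → pred e) path (bug δm)

  InF⇒¬reaches-Δ : ∀ {n m} → InF n → Star Edge n m → ¬ Δ m
  InF⇒¬reaches-Δ (_ , _ , _ , _ , n∉Q) path δm = n∉Q (reaches-Δ⇒InQ path δm)

  Trans-run⇒E-run : ∀ {q gs q'} → LRun Trans q gs q' → LRun E (proj₁ q) gs (proj₁ q')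
  Trans-run⇒E-run = LRun-map proj₁ proj₁

theorem1 : {Var Val : Set} (P P' : CFA Var Val) (D : DiffGraph P P') (π' : Path P') →
    ¬ (Covers (generateCondition D) π' × RegressionBug P P' π')
theorem1 P P' D π' ((k , k≤ , (n , _) , run , n∈F) , rb)
  with DiffGraph.sound D π' rb k k≤ n (Trans-run⇒E-run D run)
... | _ , path , δm = InF⇒¬reaches-Δ D n∈F path δm
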